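{- Run the bidirectional-search method described in the context on any sequence of arc additions to an initially arcless directed graph on a fixed vertex set. Then: (i) every bidirectional search terminates; (ii) when an arc $(v,w)$ is added, the method reports a cycle if and only if the graph obtained by adding $(v,w)$ contains a cycle, and a reported cycle (path from $w$ to $x$ traversed forward, then path from $x$ to $v$ traversed backward, then $(v,w)$) is indeed a cycle; (iii) after every arc addition that does not create a cycle, the maintained vertex order is a topological order of the current graph.
   Context: Setting: a fixed finite vertex set $V$; initially there are no arcs; arcs are added one at a time (the process stops once a cycle is reported). A topological order of a directed graph is a total order $<$ of its vertices such that $x<y$ for every arc $(x,y)$. The method maintains a total order $<$ of $V$ (initially arbitrary), stored in a dynamic ordered-list structure supporting order queries, deletion of a vertex, and reinsertion of a vertex just before or just after another vertex; and for each vertex the set of its outgoing arcs and the set of its incoming arcs. To add an arc $(v,w)$: add $(v,w)$ to the outgoing set of $v$ and the incoming set of $w$. If $v<w$, nothing else is done. If $v>w$, perform a bidirectional search forward from $w$ and backward from $v$. A vertex is forward if it is $w$ or has been reached from $w$ by a path of arcs traversed forward; it is backward if it is $v$ or has been reached from $v$ by a path of arcs traversed backward. A forward vertex is scanned if all its outgoing arcs have been traversed; a backward vertex is scanned if all its incoming arcs have been traversed. The search traverses (in any order) arcs forward out of forward vertices (the head then becomes forward) and arcs backward into backward vertices (the tail then becomes backward), until either (a) a forward traversal reaches a backward vertex $x$ or a backward traversal reaches a forward vertex $x$, in which case it stops and reports the cycle consisting of a path from $w$ to $x$ traversed forward, a path from $x$ to $v$ traversed backward, and $(v,w)$; or (b)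 there is a vertex $s$ such that all forward vertices less than $s$ and all backward vertices greater than $s$ are scanned. In case (b), let $X$ be the set of forward vertices less than $s$ and $Y$ the set of backward vertices greater than $s$; compute topological orders $O_X$ and $O_Y$ of the subgraphs induced by $X$ and by $Y$. If $s$ is not forward, delete the vertices of $X\cup Y$ from the order and reinsert them just after $s$, in order $O_Y$ followed by $O_X$; otherwise ($s$ not backward) symmetrically reinsert them just before $s$, in order $O_Y$ followed by $O_X$. -}

module Defs where

open import Data.Nat using (ℕ; _≤_)
open import Data.Fin using (Fin)
open import Data.Fin.Properties using (_≟_)
open import Data.Product using (_×_; _,_; Σ; ∃; proj₁)
open import Data.List using (List; []; _∷_; _++_; filter; length)
open import Data.List.Membership.Propositional using (_∈_; _∉_)
open import Data.List.Relation.Unary.Unique.Propositional using (Unique)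
open import Relation.Nullary using (¬_; does)
open import Relation.Nullary.Decidable using (¬?)
open import Relation.Binary.PropositionalEquality using (_≡_)
open import Relation.Binary.Construct.Closure.ReflexiveTransitive using (Star)
open import Data.Bool using (if_then_else_)

module _ {n : ℕ} where

  open import Data.List.Membership.DecPropositional (_≟_ {n = n}) using (_∈?_)

  -- Vertices are Fin n; an arc is an ordered pair; a graph is a (finite) set of arcs,
  -- represented by a list (membership = set membership).
  Arc : Set
  Arc = Fin n × Fin n

  Graph : Set
  Graph = List Arc

  -- A total order of V is represented as a list of the vertices; x < y iff x occurs before y.
  _<[_]_ : Fin n → List (Fin n) → Fin n → Set
  x <[ o ] y = Σ (List (Fin n)) λ o₁ → Σ (List (Fin n)) λ o₂ → (o ≡ o₁ ++ (x ∷ o₂)) × (y ∈ o₂)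

  IsVertexOrder : List (Fin n) → Set
  IsVertexOrder o = Unique o × (∀ x → x ∈ o)

  IsTopologicalOrder : Graph → List (Fin n) → Set
  IsTopologicalOrder G o = IsVertexOrder o × (∀ x y → (x , y) ∈ G → x <[ o ] y)

  data Path (E : Fin n → Fin n → Set) : Fin n → Fin n → Set where
    []  : ∀ {x} → Path E x x
    _∷_ : ∀ {x y z} → E x y → Path E y z → Path E x z

  arcs : ∀ {E x y} → Path E x y → List Arc
  arcs {x = x} [] = []
  arcs {x = x} (_∷_ {y = y} e p) = (x , y) ∷ arcs p

  Edge : Graph → Fin n → Fin n → Set
  Edge G a b = (a , b) ∈ G

  IsCycle : Graph → List Arc → Set
  IsCycle G as = Σ (Fin n) λ x → Σ (Path (Edge G) x x) λ p → (arcs p ≡ as) × (1 ≤ length as)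

  HasCycle : Graph → Set
  HasCycle G = Σ (List Arc) λ as → IsCycle G as

  removeAll : List (Fin n) → List (Fin n) → List (Fin n)
  removeAll L o = filter (λ z → ¬? (z ∈? L)) o

  insertAfter : Fin n → List (Fin n) → List (Fin n) → List (Fin n)
  insertAfter s L [] = []
  insertAfter s L (z ∷ zs) = if does (z ≟ s) then z ∷ (L ++ zs) else z ∷ insertAfter s L zs

  insertBefore : Fin n → List (Fin n) → List (Fin n) → List (Fin n)
  insertBefore s L [] = []
  insertBefore s L (z ∷ zs) = if does (z ≟ s) then L ++ (z ∷ zs) else z ∷ insertBefore s L zs

  record SearchState : Set where
    constructor ⟨_,_,_,_⟩
    field
      fwd  : List (Fin n)
      bwd  : List (Fin n)
      tfwd : List Arc       -- arcs traversed forward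
      tbwd : List Arc       -- arcs traversed backward
  open SearchState public

  initState : Fin n → Fin n → SearchState
  initState v w = ⟨ w ∷ [] , v ∷ [] , [] , [] ⟩

  ScannedF : Graph → SearchState → Fin n → Set
  ScannedF G st x = ∀ y → (x , y) ∈ G → (x , y) ∈ tfwd st

  ScannedB : Graph → SearchState → Fin n → Set
  ScannedB G st y = ∀ x → (x , y) ∈ G → (x , y) ∈ tbwd st

  CondB : Graph → List (Fin n) → SearchState → Fin n → Set
  CondB G o st s =
    (∀ x → x ∈ fwd st → x <[ o ] s → ScannedF G st x) ×
    (∀ y → y ∈ bwd st → s <[ o ] y → ScannedB G st y)

  Stopped : Graph → List (Fin n) → SearchState → Set
  Stopped G o st = Σ (Fin n) λ s → CondB G o st s

  data Step (G : Graph) (o : List (Fin n)) : SearchState → SearchState → Set where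
    stepF : ∀ {F B TF TB} x y → x ∈ F → (x , y) ∈ G → (x , y) ∉ TF → y ∉ B →
            ¬ Stopped G o ⟨ F , B , TF , TB ⟩ →
            Step G o ⟨ F , B , TF , TB ⟩ ⟨ y ∷ F , B , (x , y) ∷ TF , TB ⟩
    stepB : ∀ {F B TF TB} x y → y ∈ B → (x , y) ∈ G → (x , y) ∉ TB → x ∉ F →
            ¬ Stopped G o ⟨ F , B , TF , TB ⟩ →
            Step G o ⟨ F , B , TF , TB ⟩ ⟨ F , x ∷ B , TF , (x , y) ∷ TB ⟩

  data Outcome : Set where
    cycleAt   : Fin n → SearchState → Outcome   -- case (a): meeting vertex x, final state
    reordered : List (Fin n) → Outcome

  IsTopOrderOfInduced : Graph → (Fin n → Set) → List (Fin n) → Set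
  IsTopOrderOfInduced G P O =
    Unique O × (∀ z → (z ∈ O → P z) × (P z → z ∈ O)) ×
    (∀ a b → (a , b) ∈ G → a ∈ O → b ∈ O → a <[ O ] b)

  data Halt (G : Graph) (o : List (Fin n)) : SearchState → Outcome → Set where
    hitF : ∀ {F B TF TB} x y → x ∈ F → (x , y) ∈ G → (x , y) ∉ TF → y ∈ B →
           ¬ Stopped G o ⟨ F , B , TF , TB ⟩ →
           Halt G o ⟨ F , B , TF , TB ⟩ (cycleAt y ⟨ y ∷ F , B , (x , y) ∷ TF , TB ⟩)
    hitB : ∀ {F B TF TB} x y → y ∈ B → (x , y) ∈ G → (x , y) ∉ TB → x ∈ F →
           ¬ Stopped G o ⟨ F , B , TF , TB ⟩ →
           Halt G o ⟨ F , B , TF , TB ⟩ (cycleAt x ⟨ F , x ∷ B , TF , (x , y) ∷ TB ⟩)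
    stopAfter : ∀ st s (OX OY : List (Fin n)) → CondB G o st s →
           IsTopOrderOfInduced G (λ z → (z ∈ fwd st) × (z <[ o ] s)) OX →
           IsTopOrderOfInduced G (λ z → (z ∈ bwd st) × (s <[ o ] z)) OY →
           s ∉ fwd st →
           Halt G o st (reordered (insertAfter s (OY ++ OX) (removeAll (OX ++ OY) o)))
    stopBefore : ∀ st s (OX OY : List (Fin n)) → CondB G o st s →
           IsTopOrderOfInduced G (λ z → (z ∈ fwd st) × (z <[ o ] s)) OX →
           IsTopOrderOfInduced G (λ z → (z ∈ bwd st) × (s <[ o ] z)) OY →
           s ∈ fwd st →
           Halt G o st (reordered (insertBefore s (OY ++ OX) (removeAll (OX ++ OY) o)))

  -- configurations (graph, order) reachable by arc additions none of which reported a cycle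
  data Reachable : Graph → List (Fin n) → Set where
    start  : ∀ o → IsVertexOrder o → Reachable [] o
    easy   : ∀ {G o} v w → Reachable G o → v <[ o ] w → Reachable ((v , w) ∷ G) o
    search : ∀ {G o} v w st o' → Reachable G o → w <[ o ] v →
             Star (Step ((v , w) ∷ G) o) (initState v w) st →
             Halt ((v , w) ∷ G) o st (reordered o') →
             Reachable ((v , w) ∷ G) o'

-- The search keeps forward and backward vertices disjoint, every forward vertex reachable from w and
-- every backward vertex reaching v along traversed arcs, so a meeting closes a cycle through (v, w);
-- it terminates because each step traverses a fresh arc. When it stops at s, the vertices X (forward,
-- below s) and Y (backward, above s) are scanned: arcs out of X end at forward vertices and arcs into Y
-- start at backward vertices. Hence, with the rest of the order kept, putting Y then X at s (before s
-- iff s is forward) sends every arc forward, and a topological order rules out cycles.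

module Submission where

open import Defs
open import Data.Nat using (ℕ; suc; _≤_; _<_; z≤n; s≤s; _+_)
open import Data.Nat.Properties using (≤-refl; m≤n⇒m≤1+n; m<n⇒m<1+n; +-mono-<-≤; +-mono-≤-<)
open import Data.Nat.Induction using (<-wellFounded)
open import Data.Fin using (Fin)
open import Data.Fin.Properties using (_≟_; any?)
open import Data.Product.Properties using (≡-dec)
open import Data.Product using (_×_; _,_; Σ; proj₁; proj₂; map₂)
open import Data.Sum using (_⊎_; inj₁; inj₂; [_,_])
open import Data.Empty using (⊥-elim)
open import Data.List using (List; []; _∷_; _++_; filter; length)
open import Data.List.Membership.Propositional using (_∈_; _∉_; find; lose)
open import Data.List.Relation.Binary.Subset.Propositional using (_⊆_)
open import Data.List.Membership.Propositional.Properties using (∈-++⁺ˡ; ∈-++⁺ʳ; ∈-++⁻; ∈-filter⁺; ∈-filter⁻; ∈-∃++)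
open import Data.List.Properties using (++-assoc)
open import Data.List.Relation.Unary.Any using (here; there)
import Data.List.Relation.Unary.Any as Any
open import Data.List.Relation.Unary.AllPairs using (_∷_)
import Data.List.Relation.Unary.All as All
open import Data.List.Relation.Unary.All.Properties using (All¬⇒¬Any)
open import Data.List.Relation.Unary.Unique.Propositional using (Unique)
import Data.List.Relation.Unary.Unique.Propositional.Properties as Unique
open import Data.List.Relation.Binary.Permutation.Propositional using (↭-sym; ↭⇒↭ₛ)
open import Data.List.Relation.Binary.Permutation.Propositional.Properties using (shifts)
import Data.List.Relation.Binary.Permutation.Setoid.Properties as ↭ₛ
import Data.List.Membership.DecPropositional as DecMembership
open import Relation.Nullary using (¬_; Dec; yes; no)
open import Relation.Nullary.Decidable using (¬?; map′; _×-dec_; _→-dec_; decidable-stable)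
open import Relation.Unary using (Pred; Decidable)
open import Relation.Binary.Definitions using (DecidableEquality)
open import Relation.Binary.Construct.Closure.ReflexiveTransitive using (Star; ε; _◅_)
open import Induction.WellFounded using (Acc; WellFounded; module Subrelation)
import Relation.Binary.Construct.On as On
open import Function using (flip; _∘_)
open import Relation.Binary.PropositionalEquality using (_≡_; _≢_; refl; sym; trans; cong; cong₂; subst; setoid)
open import Relation.Binary.PropositionalEquality using (module ≡-Reasoning)
open ≡-Reasoning

module _ {a} {A : Set a} where

  private variable
    x y z c : A
    xs ys zs o : List A

  data Before : List A → A → A → Set a where
    now   : y ∈ zs → Before (x ∷ zs) x y
    later : Before zs x y → Before (c ∷ zs) x y

  Before⇒∈ʳ : Before o x y → y ∈ o
  Before⇒∈ʳ (now p)   = there p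
  Before⇒∈ʳ (later b) = there (Before⇒∈ʳ b)

  head∉tail : Unique (x ∷ xs) → x ∉ xs
  head∉tail (x∉ ∷ _) = All¬⇒¬Any x∉

  Before-irrefl : Unique o → ¬ Before o x x
  Before-irrefl u       (now p)   = head∉tail u p
  Before-irrefl (_ ∷ u) (later b) = Before-irrefl u b

  Before-trans : Unique o → Before o x y → Before o y z → Before o x z
  Before-trans u       (now p)   (now q)   = ⊥-elim (head∉tail u p)
  Before-trans u       (now p)   (later q) = now (Before⇒∈ʳ q)
  Before-trans u       (later p) (now q)   = ⊥-elim (head∉tail u (Before⇒∈ʳ p))
  Before-trans (_ ∷ u) (later p) (later q) = later (Before-trans u p q)

  Before-asym : Unique o → Before o x y → ¬ Before o y x
  Before-asym u p q = Before-irrefl u (Before-trans u p q)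

  Before-++-∈ : x ∈ xs → y ∈ ys → Before (xs ++ ys) x y
  Before-++-∈ {xs = _ ∷ xs} (here refl) q = now (∈-++⁺ʳ xs q)
  Before-++-∈ {xs = _ ∷ xs} (there p)   q = later (Before-++-∈ p q)

  Before-++⁺ˡ : Before xs x y → Before (xs ++ ys) x y
  Before-++⁺ˡ (now p)   = now (∈-++⁺ˡ p)
  Before-++⁺ˡ (later b) = later (Before-++⁺ˡ b)

  Before-++⁺ʳ : ∀ xs → Before ys x y → Before (xs ++ ys) x y
  Before-++⁺ʳ []       b = b
  Before-++⁺ʳ (_ ∷ xs) b = later (Before-++⁺ʳ xs b)

  Before-insert : ∀ xs ys → Before (xs ++ zs) x y → Before (xs ++ ys ++ zs) x y
  Before-insert []       ys b = Before-++⁺ʳ ys b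
  Before-insert (_ ∷ xs) ys (now p) with ∈-++⁻ xs p
  ... | inj₁ q = now (∈-++⁺ˡ q)
  ... | inj₂ q = now (∈-++⁺ʳ xs (∈-++⁺ʳ ys q))
  Before-insert (_ ∷ xs) ys (later b) = later (Before-insert xs ys b)

  Unique-insert : ∀ xs ys → Unique (xs ++ zs) → Unique ys →
                  (∀ {z} → z ∈ ys → z ∉ xs ++ zs) → Unique (xs ++ ys ++ zs)
  Unique-insert xs ys uxz uy disjoint =
    ↭ₛ.Unique-resp-↭ (setoid A) (↭⇒↭ₛ (↭-sym (shifts xs ys)))
      (Unique.++⁺ uy uxz λ (z∈ys , z∈xz) → disjoint z∈ys z∈xz)

  1≤length-++-++-∷ : ∀ xs ys → 1 ≤ length (xs ++ ys ++ x ∷ [])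
  1≤length-++-++-∷ (_ ∷ _) _       = s≤s z≤n
  1≤length-++-++-∷ []      (_ ∷ _) = s≤s z≤n
  1≤length-++-++-∷ []      []      = s≤s z≤n

  module _ {p} {P : Pred A p} (P? : Decidable P) where

    Before-filter⁻ : Before (filter P? o) x y → Before o x y
    Before-filter⁻ {o = c ∷ o} b with P? c
    Before-filter⁻ {o = c ∷ o} (now q)   | yes _ = now (proj₁ (∈-filter⁻ P? q))
    Before-filter⁻ {o = c ∷ o} (later b) | yes _ = later (Before-filter⁻ b)
    ... | no _ = later (Before-filter⁻ b)

    Before-filter⁺ : P x → P y → Before o x y → Before (filter P? o) x y
    Before-filter⁺ {o = c ∷ o} px py (now q) with P? c
    ... | yes _  = now (∈-filter⁺ P? q py)
    ... | no ¬pc = ⊥-elim (¬pc px)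
    Before-filter⁺ {o = c ∷ o} px py (later b) with P? c
    ... | yes _ = later (Before-filter⁺ px py b)
    ... | no _  = Before-filter⁺ px py b

  ∀∈? : ∀ {p} {P : Pred A p} → Decidable P → ∀ xs → Dec (∀ {x} → x ∈ xs → P x)
  ∀∈? P? xs = map′ All.lookup All.tabulate (All.all? P? xs)

  module _ (_≟_ : DecidableEquality A) where
    open DecMembership _≟_ using (_∈?_)

    Before? : ∀ o x y → Dec (Before o x y)
    Before? []      x y = no λ ()
    Before? (c ∷ o) x y with c ≟ x | y ∈? o | Before? o x y
    ... | _        | _      | yes b  = yes (later b)
    ... | yes refl | yes p  | no _   = yes (now p)
    ... | yes refl | no ¬p  | no ¬b  = no λ { (now p) → ¬p p ; (later b) → ¬b b }
    ... | no c≢x   | _      | no ¬b  = no λ { (now p) → c≢x refl ; (later b) → ¬b b }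

module _ {n : ℕ} where

  private variable
    x y z : Fin n
    o : List (Fin n)
    G : Graph {n}
    E E′ : Fin n → Fin n → Set
    a b : Fin n
    T T′ : List (Arc {n})
    t : Arc {n}

  <[]⇒Before : x <[ o ] y → Before o x y
  <[]⇒Before ([]     , _ , refl , p) = now p
  <[]⇒Before (_ ∷ o₁ , _ , refl , p) = later (<[]⇒Before (o₁ , _ , refl , p))

  Before⇒<[] : Before o x y → x <[ o ] y
  Before⇒<[] (now {zs = zs} p) = [] , zs , refl , p
  Before⇒<[] {o = c ∷ _} (later b) with Before⇒<[] b
  ... | o₁ , o₂ , refl , p = c ∷ o₁ , o₂ , refl , p

  mapₚ : (∀ {a b} → E a b → E′ a b) → Path E x y → Path E′ x y
  mapₚ f []      = []
  mapₚ f (e ∷ p) = f e ∷ mapₚ f p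

  _++ₚ_ : Path E x y → Path E y z → Path E x z
  []      ++ₚ q = q
  (e ∷ p) ++ₚ q = e ∷ (p ++ₚ q)

  arcs-mapₚ : (f : ∀ {a b} → E a b → E′ a b) (p : Path E x y) → arcs (mapₚ f p) ≡ arcs p
  arcs-mapₚ f []      = refl
  arcs-mapₚ f (e ∷ p) = cong (_ ∷_) (arcs-mapₚ f p)

  arcs-++ₚ : (p : Path E x y) (q : Path E y z) → arcs (p ++ₚ q) ≡ arcs p ++ arcs q
  arcs-++ₚ []      q = refl
  arcs-++ₚ (e ∷ p) q = cong (_ ∷_) (arcs-++ₚ p q)

  nonemptyPath⇒Before : Unique o → (∀ {a b} → E a b → Before o a b) →
                        E x y → Path E y z → Before o x z
  nonemptyPath⇒Before u ord e []       = ord e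
  nonemptyPath⇒Before u ord e (f ∷ p) = Before-trans u (ord e) (nonemptyPath⇒Before u ord f p)

  ∷-topological : IsTopologicalOrder G o → x <[ o ] y → IsTopologicalOrder ((x , y) ∷ G) o
  ∷-topological (vo , ord) x<y = vo , λ { _ _ (here refl) → x<y ; a b (there ab) → ord a b ab }

  topological⇒acyclic : IsTopologicalOrder G o → ¬ HasCycle G
  topological⇒acyclic ((u , _) , ord) (_ , _ , []    , refl , ())
  topological⇒acyclic ((u , _) , ord) (_ , _ , e ∷ p , _) =
    Before-irrefl u (nonemptyPath⇒Before u (λ e → <[]⇒Before (ord _ _ e)) e p)

  closingCycle : (∀ {a b} → E a b → (a , b) ∈ G) → (∀ {a b} → E′ a b → (a , b) ∈ G) →
                 (x , y) ∈ G → (p : Path E y z) (q : Path E′ z x) →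
                 IsCycle G (arcs p ++ arcs q ++ (x , y) ∷ [])
  closingCycle {G = G} {x = x} {y} E⊆G E′⊆G xy p q =
    y , cycle , arcs-cycle , 1≤length-++-++-∷ (arcs p) (arcs q)
    where
      cycle : Path (Edge G) y y
      cycle = mapₚ E⊆G p ++ₚ (mapₚ E′⊆G q ++ₚ (xy ∷ []))
      arcs-cycle : arcs cycle ≡ arcs p ++ arcs q ++ (x , y) ∷ []
      arcs-cycle = begin
        arcs cycle                                                ≡⟨ arcs-++ₚ (mapₚ E⊆G p) _ ⟩
        arcs (mapₚ E⊆G p) ++ arcs (mapₚ E′⊆G q ++ₚ (xy ∷ []))     ≡⟨ cong₂ _++_ (arcs-mapₚ E⊆G p) (arcs-++ₚ (mapₚ E′⊆G q) _) ⟩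
        arcs p ++ arcs (mapₚ E′⊆G q) ++ (x , y) ∷ []              ≡⟨ cong (λ as → arcs p ++ as ++ _) (arcs-mapₚ E′⊆G q) ⟩
        arcs p ++ arcs q ++ (x , y) ∷ []                          ∎

  <[]? : ∀ x o y → Dec (x <[ o ] y)
  <[]? x o y = map′ Before⇒<[] <[]⇒Before (Before? _≟_ o x y)

  filter-isTopOrderOfInduced : IsVertexOrder o → {P : Fin n → Set} (P? : Decidable P) →
    (∀ {a b} → (a , b) ∈ G → P a → P b → Before o a b) → IsTopOrderOfInduced G P (filter P? o)
  filter-isTopOrderOfInduced {o = o} (u , complete) {P} P? ord =
    Unique.filter⁺ P? u ,
    (λ z → P-of , ∈-filter⁺ P? (complete z)) ,
    λ a b ab a∈ b∈ → Before⇒<[] (Before-filter⁺ P? (P-of a∈) (P-of b∈) (ord ab (P-of a∈) (P-of b∈)))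
    where
      P-of : ∀ {z} → z ∈ filter P? o → P z
      P-of z∈ = proj₂ (∈-filter⁻ P? {xs = o} z∈)

  open DecMembership (_≟_ {n}) using (_∈?_)

  insertAfter-split : ∀ {s : Fin n} M xs ys → s ∉ xs → insertAfter s M (xs ++ s ∷ ys) ≡ xs ++ s ∷ M ++ ys
  insertAfter-split {s} M [] ys _ with s ≟ s
  ... | yes _  = refl
  ... | no s≢s = ⊥-elim (s≢s refl)
  insertAfter-split {s} M (z ∷ xs) ys s∉ with z ≟ s
  ... | yes refl = ⊥-elim (s∉ (here refl))
  ... | no _     = cong (z ∷_) (insertAfter-split M xs ys (s∉ ∘ there))

  insertBefore-split : ∀ {s : Fin n} M xs ys → s ∉ xs → insertBefore s M (xs ++ s ∷ ys) ≡ xs ++ M ++ s ∷ ys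
  insertBefore-split {s} M [] ys _ with s ≟ s
  ... | yes _  = refl
  ... | no s≢s = ⊥-elim (s≢s refl)
  insertBefore-split {s} M (z ∷ xs) ys s∉ with z ≟ s
  ... | yes refl = ⊥-elim (s∉ (here refl))
  ... | no _     = cong (z ∷_) (insertBefore-split M xs ys (s∉ ∘ there))

  open DecMembership (≡-dec (_≟_ {n}) (_≟_ {n})) using () renaming (_∈?_ to _∈ₐ?_)

  untraversed : List (Arc {n}) → Graph {n} → ℕ
  untraversed T []      = 0
  untraversed T (e ∷ L) with e ∈ₐ? T
  ... | yes _ = untraversed T L
  ... | no  _ = suc (untraversed T L)

  untraversed-antimono : T ⊆ T′ → ∀ L → untraversed T′ L ≤ untraversed T L
  untraversed-antimono sub [] = z≤n
  untraversed-antimono {T} {T′} sub (e ∷ L) with e ∈ₐ? T | e ∈ₐ? T′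
  ... | yes _ | yes _   = untraversed-antimono sub L
  ... | yes p | no e∉T′ = ⊥-elim (e∉T′ (sub p))
  ... | no _  | yes _   = m≤n⇒m≤1+n (untraversed-antimono sub L)
  ... | no _  | no _    = s≤s (untraversed-antimono sub L)

  untraversed-strict : ∀ {L} → T ⊆ T′ → t ∈ L → t ∈ T′ → t ∉ T → untraversed T′ L < untraversed T L
  untraversed-strict {T} {T′} {L = e ∷ L} sub (here refl) t∈T′ t∉T with e ∈ₐ? T | e ∈ₐ? T′
  ... | yes t∈T | _       = ⊥-elim (t∉T t∈T)
  ... | no _    | yes _   = s≤s (untraversed-antimono sub L)
  ... | no _    | no t∉T′ = ⊥-elim (t∉T′ t∈T′)
  untraversed-strict {T} {T′} {L = e ∷ L} sub (there t∈L) t∈T′ t∉T with e ∈ₐ? T | e ∈ₐ? T′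
  ... | yes _ | yes _   = untraversed-strict sub t∈L t∈T′ t∉T
  ... | yes p | no e∉T′ = ⊥-elim (e∉T′ (sub p))
  ... | no _  | yes _   = m<n⇒m<1+n (untraversed-strict sub t∈L t∈T′ t∉T)
  ... | no _  | no _    = s≤s (untraversed-strict sub t∈L t∈T′ t∉T)

  module Search (G : Graph {n}) (o : List (Fin n)) (v w : Fin n) where

    G′ : Graph {n}
    G′ = (v , w) ∷ G

    remaining : SearchState {n} → ℕ
    remaining st = untraversed (tfwd st) G′ + untraversed (tbwd st) G′

    Step⇒remaining< : ∀ {st st′} → Step G′ o st st′ → remaining st′ < remaining st
    Step⇒remaining< (stepF {TB = TB} _ _ _ xy∈G′ xy∉TF _ _) =
      +-mono-<-≤ (untraversed-strict there xy∈G′ (here refl) xy∉TF) (≤-refl {untraversed TB G′})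
    Step⇒remaining< (stepB {TF = TF} _ _ _ xy∈G′ xy∉TB _ _) =
      +-mono-≤-< (≤-refl {untraversed TF G′}) (untraversed-strict there xy∈G′ (here refl) xy∉TB)

    Step-wellFounded : WellFounded (flip (Step G′ o))
    Step-wellFounded = Subrelation.wellFounded Step⇒remaining< (On.wellFounded remaining <-wellFounded)

    record Invariant (st : SearchState {n}) : Set where
      field
        v∈bwd    : v ∈ bwd st
        w∈fwd    : w ∈ fwd st
        disjoint : x ∈ fwd st → x ∉ bwd st
        tfwd⊆G′  : (a , b) ∈ tfwd st → (a , b) ∈ G′
        tbwd⊆G′  : (a , b) ∈ tbwd st → (a , b) ∈ G′
        tfwd-fwd : (a , b) ∈ tfwd st → b ∈ fwd st
        tbwd-bwd : (a , b) ∈ tbwd st → a ∈ bwd st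
        fwdPath  : x ∈ fwd st → Path (λ a b → (a , b) ∈ tfwd st) w x
        bwdPath  : x ∈ bwd st → Path (λ a b → (a , b) ∈ tbwd st) x v
    open Invariant public

    Invariant-init : v ≢ w → Invariant (initState v w)
    Invariant-init v≢w = record
      { v∈bwd    = here refl
      ; w∈fwd    = here refl
      ; disjoint = λ { (here refl) (here w≡v) → v≢w (sym w≡v) }
      ; tfwd⊆G′  = λ ()
      ; tbwd⊆G′  = λ ()
      ; tfwd-fwd = λ ()
      ; tbwd-bwd = λ ()
      ; fwdPath  = λ { (here refl) → [] }
      ; bwdPath  = λ { (here refl) → [] }
      }

    Invariant-step : ∀ {st st′} → Step G′ o st st′ → Invariant st → Invariant st′
    Invariant-step (stepF x y x∈F xy∈G′ _ y∉B _) I = record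
      { v∈bwd    = v∈bwd I
      ; w∈fwd    = there (w∈fwd I)
      ; disjoint = λ { (here refl) → y∉B ; (there z∈F) → disjoint I z∈F }
      ; tfwd⊆G′  = λ { (here refl) → xy∈G′ ; (there e) → tfwd⊆G′ I e }
      ; tbwd⊆G′  = tbwd⊆G′ I
      ; tfwd-fwd = λ { (here refl) → here refl ; (there e) → there (tfwd-fwd I e) }
      ; tbwd-bwd = tbwd-bwd I
      ; fwdPath  = λ { (here refl) → mapₚ there (fwdPath I x∈F) ++ₚ (here refl ∷ [])
                     ; (there z∈F) → mapₚ there (fwdPath I z∈F) }
      ; bwdPath  = bwdPath I
      }
    Invariant-step (stepB x y y∈B xy∈G′ _ x∉F _) I = record
      { v∈bwd    = there (v∈bwd I)
      ; w∈fwd    = w∈fwd I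
      ; disjoint = λ { z∈F (here refl) → x∉F z∈F ; z∈F (there z∈B) → disjoint I z∈F z∈B }
      ; tfwd⊆G′  = tfwd⊆G′ I
      ; tbwd⊆G′  = λ { (here refl) → xy∈G′ ; (there e) → tbwd⊆G′ I e }
      ; tfwd-fwd = tfwd-fwd I
      ; tbwd-bwd = λ { (here refl) → here refl ; (there e) → there (tbwd-bwd I e) }
      ; fwdPath  = fwdPath I
      ; bwdPath  = λ { (here refl) → here refl ∷ mapₚ there (bwdPath I y∈B)
                     ; (there z∈B) → mapₚ there (bwdPath I z∈B) }
      }

    Invariant-star : ∀ {st st′} → Star (Step G′ o) st st′ → Invariant st → Invariant st′
    Invariant-star ε             I = I
    Invariant-star (step ◅ rest) I = Invariant-star rest (Invariant-step step I)

    Invariant-reachable : v ≢ w → ∀ {st} → Star (Step G′ o) (initState v w) st → Invariant st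
    Invariant-reachable v≢w steps = Invariant-star steps (Invariant-init v≢w)

    meetingPaths : ∀ {st x st′} → Invariant st → Halt G′ o st (cycleAt x st′) →
      (∀ {a b} → (a , b) ∈ tfwd st′ → (a , b) ∈ G′) ×
      (∀ {a b} → (a , b) ∈ tbwd st′ → (a , b) ∈ G′) ×
      Path (λ a b → (a , b) ∈ tfwd st′) w x × Path (λ a b → (a , b) ∈ tbwd st′) x v
    meetingPaths I (hitF x y x∈F xy∈G′ _ y∈B _) =
      (λ { (here refl) → xy∈G′ ; (there e) → tfwd⊆G′ I e }) , tbwd⊆G′ I ,
      mapₚ there (fwdPath I x∈F) ++ₚ (here refl ∷ []) , bwdPath I y∈B
    meetingPaths I (hitB x y y∈B xy∈G′ _ x∈F _) =
      tfwd⊆G′ I , (λ { (here refl) → xy∈G′ ; (there e) → tbwd⊆G′ I e }) ,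
      fwdPath I x∈F , here refl ∷ mapₚ there (bwdPath I y∈B)

    cycleAt-sound : ∀ {st x st′} → Invariant st → Halt G′ o st (cycleAt x st′) →
      HasCycle G′ ×
      Σ (Path (λ a b → (a , b) ∈ tfwd st′) w x) (λ _ → Path (λ a b → (a , b) ∈ tbwd st′) x v) ×
      (∀ (P : Path (λ a b → (a , b) ∈ tfwd st′) w x) (Q : Path (λ a b → (a , b) ∈ tbwd st′) x v) →
        IsCycle G′ (arcs P ++ (arcs Q ++ ((v , w) ∷ []))))
    cycleAt-sound I h with meetingPaths I h
    ... | tfwd⊆ , tbwd⊆ , P , Q =
      (_ , closingCycle tfwd⊆ tbwd⊆ (here refl) P Q) , (P , Q) , closingCycle tfwd⊆ tbwd⊆ (here refl)

    ScannedF? : ∀ st x → Dec (ScannedF G′ st x)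
    ScannedF? st x = map′ (λ h y xy∈G′ → h xy∈G′ refl) (λ { h {_ , y} xy∈G′ refl → h y xy∈G′ })
      (∀∈? (λ t → proj₁ t ≟ x →-dec t ∈ₐ? tfwd st) G′)

    ScannedB? : ∀ st y → Dec (ScannedB G′ st y)
    ScannedB? st y = map′ (λ h x xy∈G′ → h xy∈G′ refl) (λ { h {x , _} xy∈G′ refl → h x xy∈G′ })
      (∀∈? (λ t → proj₂ t ≟ y →-dec t ∈ₐ? tbwd st) G′)

    CondB? : ∀ st s → Dec (CondB G′ o st s)
    CondB? st s =
      map′ (λ h x → h {x}) (λ h {x} → h x) (∀∈? (λ x → <[]? x o s →-dec ScannedF? st x) (fwd st)) ×-dec
      map′ (λ h y → h {y}) (λ h {y} → h y) (∀∈? (λ y → <[]? s o y →-dec ScannedB? st y) (bwd st))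

    haltAt : IsTopologicalOrder G o → ∀ {st} → Invariant st → ∀ s → CondB G′ o st s →
             Σ Outcome (Halt G′ o st)
    haltAt (vo , ord) {st} I s cond = haltOn (s ∈? fwd st)
      where
        X? : Decidable (λ z → z ∈ fwd st × z <[ o ] s)
        X? z = z ∈? fwd st ×-dec <[]? z o s

        Y? : Decidable (λ z → z ∈ bwd st × s <[ o ] z)
        Y? z = z ∈? bwd st ×-dec <[]? s o z

        OX-topological : IsTopOrderOfInduced G′ (λ z → z ∈ fwd st × z <[ o ] s) (filter X? o)
        OX-topological = filter-isTopOrderOfInduced vo X? λ
          { (here refl) (v∈F , _) _ → ⊥-elim (disjoint I v∈F (v∈bwd I))
          ; (there ab)  _         _ → <[]⇒Before (ord _ _ ab) }

        OY-topological : IsTopOrderOfInduced G′ (λ z → z ∈ bwd st × s <[ o ] z) (filter Y? o)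
        OY-topological = filter-isTopOrderOfInduced vo Y? λ
          { (here refl) _ (w∈B , _) → ⊥-elim (disjoint I (w∈fwd I) w∈B)
          ; (there ab)  _ _         → <[]⇒Before (ord _ _ ab) }

        haltOn : Dec (s ∈ fwd st) → Σ Outcome (Halt G′ o st)
        haltOn (yes s∈F) = _ , stopBefore st s _ _ cond OX-topological OY-topological s∈F
        haltOn (no  s∉F) = _ , stopAfter  st s _ _ cond OX-topological OY-topological s∉F

    progress : IsTopologicalOrder G o → ∀ {st} → Invariant st →
               Σ SearchState (Step G′ o st) ⊎ Σ Outcome (Halt G′ o st)
    progress top {st} I with any? (CondB? st)
    ... | yes (s , cond) = inj₂ (haltAt top I s cond)
    ... | no ¬stopped with Any.any? (λ t → proj₁ t ∈? fwd st ×-dec ¬? (t ∈ₐ? tfwd st)) G′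
    ...   | yes untraversedF with find untraversedF
    ...     | (x , y) , xy∈G′ , x∈F , xy∉TF with y ∈? bwd st
    ...       | yes y∈B = inj₂ (_ , hitF  x y x∈F xy∈G′ xy∉TF y∈B ¬stopped)
    ...       | no  y∉B = inj₁ (_ , stepF x y x∈F xy∈G′ xy∉TF y∉B ¬stopped)
    progress top {st} I | no ¬stopped | no ¬untraversedF
      with Any.any? (λ t → proj₂ t ∈? bwd st ×-dec ¬? (t ∈ₐ? tbwd st)) G′
    ... | yes untraversedB with find untraversedB
    ...   | (x , y) , xy∈G′ , y∈B , xy∉TB with x ∈? fwd st
    ...     | yes x∈F = inj₂ (_ , hitB  x y y∈B xy∈G′ xy∉TB x∈F ¬stopped)
    ...     | no  x∉F = inj₁ (_ , stepB x y y∈B xy∈G′ xy∉TB x∉F ¬stopped)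
    -- With every forward and backward vertex scanned, condition (b) holds for any s, say v.
    progress top {st} I | no ¬stopped | no ¬untraversedF | no ¬untraversedB =
      ⊥-elim (¬stopped (v , (λ x x∈F _ → scannedF x∈F) , (λ y y∈B _ → scannedB y∈B)))
      where
        scannedF : ∀ {x} → x ∈ fwd st → ScannedF G′ st x
        scannedF {x} x∈F y xy∈G′ = decidable-stable (_ ∈ₐ? tfwd st)
          λ xy∉TF → ¬untraversedF (lose xy∈G′ (x∈F , xy∉TF))
        scannedB : ∀ {y} → y ∈ bwd st → ScannedB G′ st y
        scannedB {y} y∈B x xy∈G′ = decidable-stable (_ ∈ₐ? tbwd st)
          λ xy∉TB → ¬untraversedB (lose xy∈G′ (y∈B , xy∉TB))

  module Reordering (G : Graph {n}) (o : List (Fin n)) (v w : Fin n)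
    (top : IsTopologicalOrder G o) (w<v : Before o w v)
    {st : SearchState {n}} (I : Search.Invariant G o v w st) {s : Fin n}
    (cond : CondB ((v , w) ∷ G) o st s) {OX OY : List (Fin n)}
    (OX-top : IsTopOrderOfInduced ((v , w) ∷ G) (λ z → z ∈ fwd st × z <[ o ] s) OX)
    (OY-top : IsTopOrderOfInduced ((v , w) ∷ G) (λ z → z ∈ bwd st × s <[ o ] z) OY) where

    open Search G o v w using (G′; disjoint; v∈bwd; w∈fwd; tfwd-fwd; tbwd-bwd)

    F B Moved Block Rest : List (Fin n)
    F = fwd st
    B = bwd st
    Moved = OX ++ OY
    Block = OY ++ OX
    Rest = removeAll Moved o

    unique : Unique o
    unique = proj₁ (proj₁ top)

    ord : (a , b) ∈ G → Before o a b
    ord ab = <[]⇒Before (proj₂ top _ _ ab)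

    ∈OX⇒ : z ∈ OX → z ∈ F × Before o z s
    ∈OX⇒ z∈X = map₂ <[]⇒Before (proj₁ (proj₁ (proj₂ OX-top) _) z∈X)

    ⇒∈OX : z ∈ F → Before o z s → z ∈ OX
    ⇒∈OX z∈F z<s = proj₂ (proj₁ (proj₂ OX-top) _) (z∈F , Before⇒<[] z<s)

    ∈OY⇒ : z ∈ OY → z ∈ B × Before o s z
    ∈OY⇒ z∈Y = map₂ <[]⇒Before (proj₁ (proj₁ (proj₂ OY-top) _) z∈Y)

    ⇒∈OY : z ∈ B → Before o s z → z ∈ OY
    ⇒∈OY z∈B s<z = proj₂ (proj₁ (proj₂ OY-top) _) (z∈B , Before⇒<[] s<z)

    OX-successor∈F : a ∈ OX → (a , b) ∈ G′ → b ∈ F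
    OX-successor∈F a∈X ab with ∈OX⇒ a∈X
    ... | a∈F , a<s = tfwd-fwd I (proj₁ cond _ a∈F (Before⇒<[] a<s) _ ab)

    OY-predecessor∈B : b ∈ OY → (a , b) ∈ G′ → a ∈ B
    OY-predecessor∈B b∈Y ab with ∈OY⇒ b∈Y
    ... | b∈B , s<b = tbwd-bwd I (proj₂ cond _ b∈B (Before⇒<[] s<b) _ ab)

    data Class (z : Fin n) : Set where
      movedX  : z ∈ OX → Class z
      movedY  : z ∈ OY → Class z
      unmoved : z ∉ Moved → Class z

    classify : ∀ z → Class z
    classify z with z ∈? OX | z ∈? OY
    ... | yes z∈X | _       = movedX z∈X
    ... | no _    | yes z∈Y = movedY z∈Y
    ... | no z∉X  | no z∉Y  = unmoved λ z∈Moved → [ z∉X , z∉Y ] (∈-++⁻ OX z∈Moved)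

    unmoved⇒∉OX : z ∉ Moved → z ∉ OX
    unmoved⇒∉OX z∉Moved = z∉Moved ∘ ∈-++⁺ˡ

    unmoved⇒∉OY : z ∉ Moved → z ∉ OY
    unmoved⇒∉OY z∉Moved = z∉Moved ∘ ∈-++⁺ʳ OX

    Unmoved? : Decidable (λ z → z ∉ Moved)
    Unmoved? z = ¬? (z ∈? Moved)

    -- P and Q are the unmoved vertices to the left and right of the insertion point.
    module Split (P Q : List (Fin n)) (Rest≡P++Q : Rest ≡ P ++ Q)
      (P-left  : ∀ {z} → z ∈ P → Before o z s ⊎ (z ≡ s × z ∉ F))
      (Q-right : ∀ {z} → z ∈ Q → Before o s z ⊎ (z ≡ s × z ∈ F)) where

      o′ : List (Fin n)
      o′ = P ++ Block ++ Q

      unmoved⇒P⊎Q : z ∉ Moved → z ∈ P ⊎ z ∈ Q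
      unmoved⇒P⊎Q {z} z∉Moved =
        ∈-++⁻ P (subst (z ∈_) Rest≡P++Q (∈-filter⁺ Unmoved? (proj₂ (proj₁ top) z) z∉Moved))

      P++Q⇒unmoved : z ∈ P ++ Q → z ∉ Moved
      P++Q⇒unmoved {z} z∈ = proj₂ (∈-filter⁻ Unmoved? {xs = o} (subst (z ∈_) (sym Rest≡P++Q) z∈))

      Before-P++Q : a ∉ Moved → b ∉ Moved → Before o a b → Before (P ++ Q) a b
      Before-P++Q a∉Moved b∉Moved ab =
        subst (λ r → Before r _ _) Rest≡P++Q (Before-filter⁺ Unmoved? a∉Moved b∉Moved ab)

      before-P⇒before-s : Before o x z → z ∈ P → Before o x s
      before-P⇒before-s x<z z∈P with P-left z∈P
      ... | inj₁ z<s        = Before-trans unique x<z z<s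
      ... | inj₂ (refl , _) = x<z

      unmoved-before-s⇒P : z ∉ Moved → Before o z s → z ∈ P
      unmoved-before-s⇒P z∉Moved z<s with unmoved⇒P⊎Q z∉Moved
      ... | inj₁ z∈P = z∈P
      ... | inj₂ z∈Q with Q-right z∈Q
      ...   | inj₁ s<z        = ⊥-elim (Before-asym unique z<s s<z)
      ...   | inj₂ (refl , _) = ⊥-elim (Before-irrefl unique z<s)

      unmoved-after-s⇒Q : z ∉ Moved → Before o s z → z ∈ Q
      unmoved-after-s⇒Q z∉Moved s<z with unmoved⇒P⊎Q z∉Moved
      ... | inj₂ z∈Q = z∈Q
      ... | inj₁ z∈P = ⊥-elim (Before-irrefl unique (before-P⇒before-s s<z z∈P))

      unmoved-fwd⇒Q : z ∉ Moved → z ∈ F → z ∈ Q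
      unmoved-fwd⇒Q z∉Moved z∈F with unmoved⇒P⊎Q z∉Moved
      ... | inj₂ z∈Q = z∈Q
      ... | inj₁ z∈P with P-left z∈P
      ...   | inj₁ z<s        = ⊥-elim (unmoved⇒∉OX z∉Moved (⇒∈OX z∈F z<s))
      ...   | inj₂ (_ , z∉F) = ⊥-elim (z∉F z∈F)

      unmoved-bwd⇒P : z ∉ Moved → z ∈ B → z ∈ P
      unmoved-bwd⇒P z∉Moved z∈B with unmoved⇒P⊎Q z∉Moved
      ... | inj₁ z∈P = z∈P
      ... | inj₂ z∈Q with Q-right z∈Q
      ...   | inj₁ s<z        = ⊥-elim (unmoved⇒∉OY z∉Moved (⇒∈OY z∈B s<z))
      ...   | inj₂ (_ , z∈F) = ⊥-elim (disjoint I z∈F z∈B)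

      OX⊆Block : z ∈ OX → z ∈ Block
      OX⊆Block = ∈-++⁺ʳ OY

      OY⊆Block : z ∈ OY → z ∈ Block
      OY⊆Block = ∈-++⁺ˡ

      P-before-Block : a ∈ P → b ∈ Block → Before o′ a b
      P-before-Block a∈P b∈Block = Before-++-∈ a∈P (∈-++⁺ˡ b∈Block)

      Block-before-Q : a ∈ Block → b ∈ Q → Before o′ a b
      Block-before-Q a∈Block b∈Q = Before-++⁺ʳ P (Before-++-∈ a∈Block b∈Q)

      OY-before-OX : a ∈ OY → b ∈ OX → Before o′ a b
      OY-before-OX a∈Y b∈X = Before-++⁺ʳ P (Before-++⁺ˡ (Before-++-∈ a∈Y b∈X))

      within-OX : (a , b) ∈ G′ → a ∈ OX → b ∈ OX → Before o′ a b
      within-OX ab a∈X b∈X =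
        Before-++⁺ʳ P (Before-++⁺ˡ (Before-++⁺ʳ OY (<[]⇒Before (proj₂ (proj₂ OX-top) _ _ ab a∈X b∈X))))

      within-OY : (a , b) ∈ G′ → a ∈ OY → b ∈ OY → Before o′ a b
      within-OY ab a∈Y b∈Y =
        Before-++⁺ʳ P (Before-++⁺ˡ (Before-++⁺ˡ (<[]⇒Before (proj₂ (proj₂ OY-top) _ _ ab a∈Y b∈Y))))

      -- Scannedness of X and Y excludes exactly the arcs that the new order would reverse.
      arc-G : (a , b) ∈ G → Before o′ a b
      arc-G {a} {b} ab with classify a | classify b
      ... | movedX a∈X | movedX b∈X = within-OX (there ab) a∈X b∈X
      ... | movedX a∈X | movedY b∈Y =
        ⊥-elim (disjoint I (OX-successor∈F a∈X (there ab)) (proj₁ (∈OY⇒ b∈Y)))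
      ... | movedX a∈X | unmoved b∉Moved =
        Block-before-Q (OX⊆Block a∈X) (unmoved-fwd⇒Q b∉Moved (OX-successor∈F a∈X (there ab)))
      ... | movedY a∈Y | movedX b∈X = OY-before-OX a∈Y b∈X
      ... | movedY a∈Y | movedY b∈Y = within-OY (there ab) a∈Y b∈Y
      ... | movedY a∈Y | unmoved b∉Moved =
        Block-before-Q (OY⊆Block a∈Y)
          (unmoved-after-s⇒Q b∉Moved (Before-trans unique (proj₂ (∈OY⇒ a∈Y)) (ord ab)))
      ... | unmoved a∉Moved | movedX b∈X =
        P-before-Block (unmoved-before-s⇒P a∉Moved (Before-trans unique (ord ab) (proj₂ (∈OX⇒ b∈X))))
          (OX⊆Block b∈X)
      ... | unmoved a∉Moved | movedY b∈Y =
        P-before-Block (unmoved-bwd⇒P a∉Moved (OY-predecessor∈B b∈Y (there ab))) (OY⊆Block b∈Y)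
      ... | unmoved a∉Moved | unmoved b∉Moved =
        Before-insert P Block (Before-P++Q a∉Moved b∉Moved (ord ab))

      arc-vw : Before o′ v w
      arc-vw with classify v | classify w
      ... | movedX v∈X | _          = ⊥-elim (disjoint I (proj₁ (∈OX⇒ v∈X)) (v∈bwd I))
      ... | _          | movedY w∈Y = ⊥-elim (disjoint I (w∈fwd I) (proj₁ (∈OY⇒ w∈Y)))
      ... | movedY v∈Y | movedX w∈X = OY-before-OX v∈Y w∈X
      ... | movedY v∈Y | unmoved w∉Moved =
        Block-before-Q (OY⊆Block v∈Y) (unmoved-fwd⇒Q w∉Moved (w∈fwd I))
      ... | unmoved v∉Moved | movedX w∈X =
        P-before-Block (unmoved-bwd⇒P v∉Moved (v∈bwd I)) (OX⊆Block w∈X)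
      ... | unmoved v∉Moved | unmoved w∉Moved = ⊥-elim (unmoved⇒∉OX w∉Moved (⇒∈OX (w∈fwd I) w<s))
        where
          w<s : Before o w s
          w<s = before-P⇒before-s w<v (unmoved-bwd⇒P v∉Moved (v∈bwd I))

      o′-topological : IsTopologicalOrder G′ o′
      o′-topological =
        (Unique-insert P Block unique-P++Q unique-Block Block∉P++Q , complete) , arcs-ordered
        where
          unique-P++Q : Unique (P ++ Q)
          unique-P++Q = subst Unique Rest≡P++Q (Unique.filter⁺ Unmoved? unique)

          unique-Block : Unique Block
          unique-Block = Unique.++⁺ (proj₁ OY-top) (proj₁ OX-top)
            λ (z∈Y , z∈X) → disjoint I (proj₁ (∈OX⇒ z∈X)) (proj₁ (∈OY⇒ z∈Y))

          Block∉P++Q : z ∈ Block → z ∉ P ++ Q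
          Block∉P++Q z∈Block z∈P++Q with ∈-++⁻ OY z∈Block
          ... | inj₁ z∈Y = P++Q⇒unmoved z∈P++Q (∈-++⁺ʳ OX z∈Y)
          ... | inj₂ z∈X = P++Q⇒unmoved z∈P++Q (∈-++⁺ˡ z∈X)

          complete : ∀ z → z ∈ o′
          complete z with classify z
          ... | movedX z∈X = ∈-++⁺ʳ P (∈-++⁺ˡ (OX⊆Block z∈X))
          ... | movedY z∈Y = ∈-++⁺ʳ P (∈-++⁺ˡ (OY⊆Block z∈Y))
          ... | unmoved z∉Moved with unmoved⇒P⊎Q z∉Moved
          ...   | inj₁ z∈P = ∈-++⁺ˡ z∈P
          ...   | inj₂ z∈Q = ∈-++⁺ʳ P (∈-++⁺ʳ Block z∈Q)

          arcs-ordered : ∀ a b → (a , b) ∈ G′ → a <[ o′ ] b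
          arcs-ordered _ _ (here refl) = Before⇒<[] arc-vw
          arcs-ordered _ _ (there ab)  = Before⇒<[] (arc-G ab)

    s∉Moved : s ∉ Moved
    s∉Moved s∈Moved with ∈-++⁻ OX s∈Moved
    ... | inj₁ s∈X = Before-irrefl unique (proj₂ (∈OX⇒ s∈X))
    ... | inj₂ s∈Y = Before-irrefl unique (proj₂ (∈OY⇒ s∈Y))

    s∈Rest : s ∈ Rest
    s∈Rest = ∈-filter⁺ Unmoved? (proj₂ (proj₁ top) s) s∉Moved

    R₁ R₂ : List (Fin n)
    R₁ = proj₁ (∈-∃++ s∈Rest)
    R₂ = proj₁ (proj₂ (∈-∃++ s∈Rest))

    Rest≡R₁++s∷R₂ : Rest ≡ R₁ ++ s ∷ R₂
    Rest≡R₁++s∷R₂ = proj₂ (proj₂ (∈-∃++ s∈Rest))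

    Before-Rest⇒Before-o : Before (R₁ ++ s ∷ R₂) a b → Before o a b
    Before-Rest⇒Before-o ab =
      Before-filter⁻ Unmoved? (subst (λ r → Before r _ _) (sym Rest≡R₁++s∷R₂) ab)

    s∉R₁ : s ∉ R₁
    s∉R₁ s∈R₁ = Before-irrefl unique (Before-Rest⇒Before-o (Before-++-∈ s∈R₁ (here refl)))

    R₁-before-s : z ∈ R₁ → Before o z s
    R₁-before-s z∈R₁ = Before-Rest⇒Before-o (Before-++-∈ z∈R₁ (here refl))

    s-before-R₂ : z ∈ R₂ → Before o s z
    s-before-R₂ z∈R₂ = Before-Rest⇒Before-o (Before-++⁺ʳ R₁ (now z∈R₂))

    insertAfter-topological : s ∉ F → IsTopologicalOrder G′ (insertAfter s Block Rest)
    insertAfter-topological s∉F =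
      subst (IsTopologicalOrder G′) (sym insertAfter≡)
        (Split.o′-topological (R₁ ++ s ∷ []) R₂ Rest≡ left (inj₁ ∘ s-before-R₂))
      where
        Rest≡ : Rest ≡ (R₁ ++ s ∷ []) ++ R₂
        Rest≡ = trans Rest≡R₁++s∷R₂ (sym (++-assoc R₁ (s ∷ []) R₂))

        insertAfter≡ : insertAfter s Block Rest ≡ (R₁ ++ s ∷ []) ++ Block ++ R₂
        insertAfter≡ = begin
          insertAfter s Block Rest            ≡⟨ cong (insertAfter s Block) Rest≡R₁++s∷R₂ ⟩
          insertAfter s Block (R₁ ++ s ∷ R₂)  ≡⟨ insertAfter-split Block R₁ R₂ s∉R₁ ⟩
          R₁ ++ s ∷ Block ++ R₂               ≡⟨ ++-assoc R₁ (s ∷ []) (Block ++ R₂) ⟨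
          (R₁ ++ s ∷ []) ++ Block ++ R₂       ∎

        left : z ∈ R₁ ++ s ∷ [] → Before o z s ⊎ (z ≡ s × z ∉ F)
        left z∈ with ∈-++⁻ R₁ z∈
        ... | inj₁ z∈R₁        = inj₁ (R₁-before-s z∈R₁)
        ... | inj₂ (here refl) = inj₂ (refl , s∉F)

    insertBefore-topological : s ∈ F → IsTopologicalOrder G′ (insertBefore s Block Rest)
    insertBefore-topological s∈F =
      subst (IsTopologicalOrder G′) (sym insertBefore≡)
        (Split.o′-topological R₁ (s ∷ R₂) Rest≡R₁++s∷R₂ (inj₁ ∘ R₁-before-s) right)
      where
        insertBefore≡ : insertBefore s Block Rest ≡ R₁ ++ Block ++ s ∷ R₂
        insertBefore≡ =
          trans (cong (insertBefore s Block) Rest≡R₁++s∷R₂) (insertBefore-split Block R₁ R₂ s∉R₁)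

        right : z ∈ s ∷ R₂ → Before o s z ⊎ (z ≡ s × z ∈ F)
        right (here refl) = inj₂ (refl , s∈F)
        right (there z∈R₂) = inj₁ (s-before-R₂ z∈R₂)

  reordered-topological : ∀ {v w} → IsTopologicalOrder G o → Before o w v → ∀ {st o′} →
                          Search.Invariant G o v w st →
                          Halt ((v , w) ∷ G) o st (reordered o′) → IsTopologicalOrder ((v , w) ∷ G) o′
  reordered-topological top w<v I (stopAfter _ _ _ _ cond OX-top OY-top s∉F) =
    Reordering.insertAfter-topological _ _ _ _ top w<v I cond OX-top OY-top s∉F
  reordered-topological top w<v I (stopBefore _ _ _ _ cond OX-top OY-top s∈F) =
    Reordering.insertBefore-topological _ _ _ _ top w<v I cond OX-top OY-top s∈F

  Reachable⇒topological : Reachable G o → IsTopologicalOrder G o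
  Reachable⇒topological (start _ vo)     = vo , λ _ _ ()
  Reachable⇒topological (easy _ _ r v<w) = ∷-topological (Reachable⇒topological r) v<w
  Reachable⇒topological (search {G} {o} v w _ _ r w<v steps halt) =
    reordered-topological top (<[]⇒Before w<v) (Search.Invariant-reachable G o v w v≢w steps) halt
    where
      top : IsTopologicalOrder G o
      top = Reachable⇒topological r
      v≢w : v ≢ w
      v≢w refl = Before-irrefl (proj₁ (proj₁ top)) (<[]⇒Before w<v)

theorem1 : ∀ {n} (G : Graph {n}) (o : List (Fin n)) → Reachable G o →
    IsTopologicalOrder G o ×
    (∀ (v w : Fin n) → v ≢ w →
      (v <[ o ] w → ¬ HasCycle ((v , w) ∷ G)) ×
      (w <[ o ] v →
        Acc (λ t s → Step ((v , w) ∷ G) o s t) (initState v w) ×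
        (∀ st → Star (Step ((v , w) ∷ G) o) (initState v w) st →
          Σ SearchState (λ st' → Step ((v , w) ∷ G) o st st') ⊎
          Σ Outcome (λ out → Halt ((v , w) ∷ G) o st out)) ×
        (∀ st x st' → Star (Step ((v , w) ∷ G) o) (initState v w) st →
          Halt ((v , w) ∷ G) o st (cycleAt x st') →
          HasCycle ((v , w) ∷ G) ×
          Σ (Path (λ a b → (a , b) ∈ tfwd st') w x) (λ _ → Path (λ a b → (a , b) ∈ tbwd st') x v) ×
          (∀ (P : Path (λ a b → (a , b) ∈ tfwd st') w x) (Q : Path (λ a b → (a , b) ∈ tbwd st') x v) →
            IsCycle ((v , w) ∷ G) (arcs P ++ (arcs Q ++ ((v , w) ∷ []))))) ×
        (∀ st o' → Star (Step ((v , w) ∷ G) o) (initState v w) st →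
          Halt ((v , w) ∷ G) o st (reordered o') → ¬ HasCycle ((v , w) ∷ G))))
theorem1 G o r = top , λ v w v≢w → let open Search G o v w in
    (λ v<w → topological⇒acyclic (∷-topological top v<w))
  , λ w<v →
      Step-wellFounded (initState v w)
    , (λ _ steps → progress top (Invariant-reachable v≢w steps))
    , (λ _ _ _ steps halt → cycleAt-sound (Invariant-reachable v≢w steps) halt)
    , (λ _ _ steps halt → topological⇒acyclic
         (reordered-topological top (<[]⇒Before w<v) (Invariant-reachable v≢w steps) halt))
  where
    top : IsTopologicalOrder G o
    top = Reachable⇒topological r
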